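{- Suppose $X\in m^0$ and $\bar P\in R$. Then there exists $\bar Q\in R$ with $\bar Q\le\bar P$ such that $[p_s(\bar Q)]\cap X=\emptyset$ for all $s\in{}^{<\omega}\omega$.
   Context: A tree on ${}^{<\omega}\omega$ is a nonempty subset closed under initial segments; $[p]$ is its set of infinite branches; $Succ_p(s)=\{n:s^\frown n\in p\}$. Miller forcing $\mathbb{M}$ is the set of trees $p$ with a stem (maximal node comparable with all nodes) such that every $s\in p$ has an extension $t\in p$ with $Succ_p(t)$ infinite, ordered by inclusion; elements are Miller trees. $Split(p)$ is the set of $t\in p$ with $Succ_p(t)$ infinite, and for $t\in Split(p)$, $Split_p(t)$ is the set of minimal (under extension) elements of $Split(p)$ properly extending $t$. $m^0$ is the set of $X\subseteq{}^\omega\omega$ such that every $p\in\mathbb{M}$ has an extension $q\in\mathbb{M}$ with $[q]\cap X=\emptyset$. $R$ is the set of sequences $\bar P=\langle P_s:s\in{}^{<\omega}\omega\rangle$ where each $P_s\subseteq{}^{<\omega}\omega$ is infinite, every $t\in P_s$ properly extends $s$, and distinct $t,t'\in P_s$ satisfy $t(|s|)\ne t'(|s|)$. For $\bar P\in R$, $p_s(\bar P)$ is the unique Miller tree with stem $s$ such that $Split_{p_s(\bar P)}(t)=P_t$ for all $t\in Split(p_s(\bar P))$. For $\bar P,\bar Q\in R$, $\bar P\le\bar Q$ iff $p_s(\bar P)\subseteq p_s(\bar Q)$ for all $s$. -}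

module Defs where

open import Data.Nat using (ℕ; zero; suc)
open import Data.List using (List; []; _∷_; _++_; [_])
open import Data.List.Membership.Propositional using (_∈_)
open import Data.Product using (Σ; ∃; ∃-syntax; _×_; _,_)
open import Data.Sum using (_⊎_)
open import Relation.Nullary using (¬_)
open import Relation.Binary.PropositionalEquality using (_≡_; _≢_)

-- finite sequences ^{<ω}ω are lists of naturals; s ⁀ n is s ++ [ n ]
Seq : Set
Seq = List ℕ

_⊑_ : Seq → Seq → Set
s ⊑ t = ∃[ u ] (s ++ u ≡ t)

_⊏_ : Seq → Seq → Set
s ⊏ t = ∃[ n ] ∃[ u ] (t ≡ s ++ (n ∷ u))

Comparable : Seq → Seq → Set
Comparable s t = s ⊑ t ⊎ t ⊑ s

Infinite : {A : Set} → (A → Set) → Set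
Infinite {A} P = (l : List A) → ∃[ a ] (P a × ¬ (a ∈ l))

Tree : Set₁
Tree = Seq → Set

IsTree : Tree → Set
IsTree T = T [] × (∀ s t → s ⊑ t → T t → T s)

Succ : Tree → Seq → ℕ → Set
Succ T s n = T (s ++ [ n ])

_↾_ : (ℕ → ℕ) → ℕ → Seq
x ↾ zero = []
x ↾ suc n = (x ↾ n) ++ [ x n ]

Branch : Tree → (ℕ → ℕ) → Set
Branch T x = ∀ n → T (x ↾ n)

IsStem : Tree → Seq → Set
IsStem T st =
  T st × (∀ t → T t → Comparable st t)
       × (∀ u → T u → (∀ t → T t → Comparable u t) → u ⊑ st)

IsMiller : Tree → Set
IsMiller T =
  IsTree T × (∃[ st ] IsStem T st)
           × (∀ s → T s → ∃[ t ] (s ⊑ t × T t × Infinite (Succ T t)))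

Miller : Set₁
Miller = Σ Tree IsMiller

_≤M_ : Miller → Miller → Set
(q , _) ≤M (p , _) = ∀ s → q s → p s

InM0 : ((ℕ → ℕ) → Set) → Set₁
InM0 X = (p : Miller) → Σ Miller λ q → q ≤M p × (∀ x → Branch (Σ.proj₁ q) x → ¬ X x)

-- families ⟨P_s : s ∈ ^{<ω}ω⟩ : P s t means t ∈ P_s
Family : Set₁
Family = Seq → Seq → Set

InR : Family → Set
InR P = ∀ s →
    Infinite (P s)
  × (∀ t → P s t → s ⊏ t)
  × (∀ t t' n n' u u' → P s t → P s t' → t ≢ t'
       → t ≡ s ++ (n ∷ u) → t' ≡ s ++ (n' ∷ u') → n ≢ n')

-- splitting nodes of p_s(P): generated from s by P
data Nodes (P : Family) (s : Seq) : Seq → Set where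
  base : Nodes P s s
  step : ∀ {u v} → Nodes P s u → P u v → Nodes P s v

ps : Family → Seq → Tree
ps P s t = ∃[ u ] (Nodes P s u × t ⊑ u)

_≤R_ : Family → Family → Set
Q ≤R P = ∀ s t → ps Q s t → ps P s t

-- A fusion argument. Each s carries a superperfect tree A_s ⊆ p_s(P) in which s splits. The
-- members y_k of Q_s are found by choosing successors s⁀n_k in A_s with n_k increasing and
-- above a bound b_s, a splitting node z_k ⊒ s⁀n_k, an X-avoiding Miller subtree of A_s
-- restricted to z_k (this is where X ∈ m⁰ is used), and a splitting node y_k of that subtree;
-- the subtree restricted to y_k becomes A_{y_k}. Then A shrinks along Q, so a branch of p_s(Q)
-- lies in the X-avoiding tree chosen for the member of Q_s it passes through. For A_y to be well
-- defined, y may belong to Q_s for only one s: b_s is chosen above y(|s|) for every y ∈ Q_p,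
-- p ⊏ s, that could extend s. Sequences belonging to no Q_s get A_y = p_y(P).

module Submission where

open import Defs
open import Data.Nat using (ℕ; zero; suc; _+_; _≤_; _<_; z≤n; s≤s; _≟_)
open import Data.Nat.Properties
  using ( ≤-refl; ≤-trans; ≤-reflexive; <-trans; ≤-<-trans; <-irrefl; <-cmp; <⇒≱; ≮⇒≥; ≤-pred; ≤∧≢⇒<
        ; +-comm; m≤m+n; m≤n+m; m<m+n)
open import Data.List using (List; []; _∷_; _++_; [_]; _∷ʳ_; length; reverse; map; concatMap; upTo)
open import Data.List.Properties
  using ( ∷-injective; ∷-injectiveˡ; ∷-injectiveʳ; ++-assoc; ++-identityʳ; length-++
        ; reverse-++; unfold-reverse; reverse-involutive; ≡-dec)
open import Data.List.Extrema.Nat using (max; xs≤max)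
open import Data.List.Membership.Propositional using (_∈_; find; lose)
open import Data.List.Membership.Propositional.Properties
  using (∈-map⁺; ∈-map⁻; ∈-upTo⁺; ∈-concatMap⁺; ∈-concatMap⁻)
open import Data.List.Relation.Unary.Any as Any using (Any; here; there; any?)
import Data.List.Relation.Unary.All as All
open import Data.Product using (Σ; ∃-syntax; _×_; _,_; proj₁; proj₂)
open import Data.Sum using (_⊎_; inj₁; inj₂; [_,_]′)
open import Function using (id)
open import Data.Empty using (⊥; ⊥-elim)
open import Relation.Nullary using (¬_; Dec; yes; no)
open import Relation.Unary using (_⊆′_)
open import Relation.Binary.Definitions using (DecidableEquality; tri<; tri≈; tri>)
open import Relation.Binary.PropositionalEquality using (_≡_; _≢_; refl; sym; trans; cong; subst; module ≡-Reasoning)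

-- Finite sequences

⊑-refl : ∀ s → s ⊑ s
⊑-refl s = [] , ++-identityʳ s

⊑-[] : ∀ s → [] ⊑ s
⊑-[] s = s , refl

⊑-++ : ∀ s u → s ⊑ (s ++ u)
⊑-++ s u = u , refl

⊑-trans : ∀ {s t u} → s ⊑ t → t ⊑ u → s ⊑ u
⊑-trans {s} (a , refl) (b , refl) = a ++ b , sym (++-assoc s a b)

⊏⇒⊑ : ∀ {s t} → s ⊏ t → s ⊑ t
⊏⇒⊑ (n , u , eq) = n ∷ u , sym eq

∷-⊑ : ∀ {a s t} → s ⊑ t → (a ∷ s) ⊑ (a ∷ t)
∷-⊑ {a} (u , eq) = u , cong (a ∷_) eq

⊑⇒≡⊎⊏ : ∀ {s t} → s ⊑ t → s ≡ t ⊎ s ⊏ t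
⊑⇒≡⊎⊏ {s} ([] , refl) = inj₁ (sym (++-identityʳ s))
⊑⇒≡⊎⊏ (n ∷ u , refl) = inj₂ (n , u , refl)

⊑-comparable : ∀ {s t} x → s ⊑ x → t ⊑ x → Comparable s t
⊑-comparable {[]} {t} _ _ _ = inj₁ (⊑-[] t)
⊑-comparable {a ∷ s} {[]} _ _ _ = inj₂ (⊑-[] (a ∷ s))
⊑-comparable {a ∷ s} {b ∷ t} (c ∷ x) (u , eq) (v , eq') with ∷-injective eq | ∷-injective eq'
... | refl , s⊑x | refl , t⊑x with ⊑-comparable x (u , s⊑x) (v , t⊑x)
...   | inj₁ s⊑t = inj₁ (∷-⊑ s⊑t)
...   | inj₂ t⊑s = inj₂ (∷-⊑ t⊑s)

comparable-sym : ∀ {s t} → Comparable s t → Comparable t s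
comparable-sym (inj₁ s⊑t) = inj₂ s⊑t
comparable-sym (inj₂ t⊑s) = inj₁ t⊑s

length-⊑ : ∀ {s t} → s ⊑ t → length s ≤ length t
length-⊑ {s} (u , refl) = ≤-trans (m≤m+n (length s) (length u)) (≤-reflexive (sym (length-++ s)))

length-⊏ : ∀ {s t} → s ⊏ t → length s < length t
length-⊏ {s} (n , u , refl) = subst (length s <_) (sym (length-++ s)) (m<m+n (length s) (s≤s z≤n))

⊏⇒⋢ : ∀ {s t} → s ⊏ t → ¬ (t ⊑ s)
⊏⇒⋢ s⊏t t⊑s = <⇒≱ (length-⊏ s⊏t) (length-⊑ t⊑s)

⊑-length-≡ : ∀ {s t} → s ⊑ t → length s ≡ length t → s ≡ t
⊑-length-≡ s⊑t eq with ⊑⇒≡⊎⊏ s⊑t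
... | inj₁ s≡t = s≡t
... | inj₂ s⊏t = ⊥-elim (<-irrefl eq (length-⊏ s⊏t))

⊑-same-length : ∀ {s t} x → s ⊑ x → t ⊑ x → length s ≡ length t → s ≡ t
⊑-same-length x s⊑x t⊑x eq with ⊑-comparable x s⊑x t⊑x
... | inj₁ s⊑t = ⊑-length-≡ s⊑t eq
... | inj₂ t⊑s = sym (⊑-length-≡ t⊑s (sym eq))

snoc-⊑ : ∀ u a r → (u ∷ʳ a) ⊑ (u ++ (a ∷ r))
snoc-⊑ u a r = r , ++-assoc u [ a ] r

⊏⇒snoc-⊑ : ∀ {u y} → u ⊏ y → ∃[ a ] ((u ∷ʳ a) ⊑ y)
⊏⇒snoc-⊑ {u} (a , r , refl) = a , snoc-⊑ u a r

⊑-snoc-form : ∀ {u a y} → (u ∷ʳ a) ⊑ y → ∃[ r ] (y ≡ u ++ (a ∷ r))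
⊑-snoc-form {u} {a} (r , refl) = r , ++-assoc u [ a ] r

snoc-⊑-unique : ∀ u {a b x} → (u ∷ʳ a) ⊑ x → (u ∷ʳ b) ⊑ x → a ≡ b
snoc-⊑-unique [] (w , refl) (w' , eq) = sym (∷-injectiveˡ eq)
snoc-⊑-unique (c ∷ u) (w , refl) (w' , eq) = snoc-⊑-unique u (w , refl) (w' , ∷-injectiveʳ eq)

⊑-snoc-split : ∀ {s} u a → s ⊑ (u ∷ʳ a) → s ≡ u ∷ʳ a ⊎ s ⊑ u
⊑-snoc-split {[]} u a _ = inj₂ (⊑-[] u)
⊑-snoc-split {b ∷ []} [] a (w , eq) = inj₁ (cong [_] (∷-injectiveˡ eq))
⊑-snoc-split {b ∷ c ∷ s} [] a (w , ())
⊑-snoc-split {b ∷ s} (c ∷ u) a (w , eq) with ∷-injective eq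
... | refl , s⊑ua with ⊑-snoc-split u a (w , s⊑ua)
...   | inj₁ s≡ua = inj₁ (cong (b ∷_) s≡ua)
...   | inj₂ s⊑u = inj₂ (∷-⊑ s⊑u)

snoc-⊑-or-⊑ : ∀ {y a m} x → (y ∷ʳ a) ⊑ x → m ⊑ x → (y ∷ʳ a) ⊑ m ⊎ m ⊑ y
snoc-⊑-or-⊑ {y} {a} x ya⊑x m⊑x with ⊑-comparable x ya⊑x m⊑x
... | inj₁ ya⊑m = inj₁ ya⊑m
... | inj₂ m⊑ya with ⊑-snoc-split y a m⊑ya
...   | inj₁ refl = inj₁ (⊑-refl _)
...   | inj₂ m⊑y = inj₂ m⊑y

reverse-extension : ∀ (p : Seq) a w → reverse (p ++ (a ∷ w)) ≡ reverse w ++ (a ∷ reverse p)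
reverse-extension p a w = begin
  reverse (p ++ (a ∷ w))         ≡⟨ reverse-++ p (a ∷ w) ⟩
  reverse (a ∷ w) ++ reverse p   ≡⟨ cong (_++ reverse p) (unfold-reverse a w) ⟩
  (reverse w ∷ʳ a) ++ reverse p  ≡⟨ ++-assoc (reverse w) [ a ] (reverse p) ⟩
  reverse w ++ (a ∷ reverse p)   ∎
  where open ≡-Reasoning

-- at s i is s(i), with junk value 0 past the end of s.
at : Seq → ℕ → ℕ
at [] _ = 0
at (a ∷ s) zero = a
at (a ∷ s) (suc i) = at s i

at-snoc-⊑ : ∀ u {a x} → (u ∷ʳ a) ⊑ x → at x (length u) ≡ a
at-snoc-⊑ [] (w , refl) = refl
at-snoc-⊑ (c ∷ u) (w , refl) = at-snoc-⊑ u (w , refl)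

length-↾ : ∀ x n → length (x ↾ n) ≡ n
length-↾ x zero = refl
length-↾ x (suc n) = trans (length-++ (x ↾ n)) (trans (cong (_+ 1) (length-↾ x n)) (+-comm n 1))

↾-⊑ : ∀ x {m n} → m ≤ n → (x ↾ m) ⊑ (x ↾ n)
↾-⊑ x {m} {zero} z≤n = ⊑-refl []
↾-⊑ x {m} {suc n} m≤1+n with m ≟ suc n
... | yes refl = ⊑-refl _
... | no m≢1+n = ⊑-trans (↾-⊑ x (≤-pred (≤∧≢⇒< m≤1+n m≢1+n))) (⊑-++ (x ↾ n) [ x n ])

-- Infinite sets

infinite⇒unbounded : {S : ℕ → Set} → Infinite S → ∀ M → ∃[ n ] (M < n × S n)
infinite⇒unbounded inf M with inf (upTo (suc M))
... | n , Sn , n∉ = n , ≮⇒≥ (λ n<1+M → n∉ (∈-upTo⁺ n<1+M)) , Sn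

unbounded⇒infinite : {S : ℕ → Set} → (∀ M → ∃[ n ] (M < n × S n)) → Infinite S
unbounded⇒infinite unbounded l with unbounded (max 0 l)
... | n , max<n , Sn = n , Sn , λ n∈l → <⇒≱ max<n (All.lookup (xs≤max 0 l) n∈l)

module _ {A B : Set} {P : A → Set} (f : A → B) where

  Image : B → Set
  Image b = ∃[ a ] (P a × f a ≡ b)

  infinite-preimage : Infinite Image → Infinite P
  infinite-preimage inf l with inf (map f l)
  ... | _ , (a , Pa , refl) , fa∉ = a , Pa , λ a∈l → fa∉ (∈-map⁺ f a∈l)

  -- Fresh values are found one at a time: if the first candidate hits the excluded value b,
  -- a second candidate distinct from it cannot hit b as well.
  infinite-image : DecidableEquality B → (∀ {a a'} → P a → P a' → f a ≡ f a' → a ≡ a')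
                 → Infinite P → Infinite Image
  infinite-image _≟ᴮ_ injective inf l =
    let a , Pa , _ , fa∉ = fresh l [] in f a , (a , Pa , refl) , fa∉
    where
    fresh : ∀ bs as → ∃[ a ] (P a × ¬ (a ∈ as) × ¬ (f a ∈ bs))
    fresh [] as with inf as
    ... | a , Pa , a∉ = a , Pa , a∉ , λ ()
    fresh (b ∷ bs) as with fresh bs as
    ... | a , Pa , a∉ , fa∉ with f a ≟ᴮ b
    ...   | no fa≢b = a , Pa , a∉ , λ { (here fa≡b) → fa≢b fa≡b ; (there m) → fa∉ m }
    ...   | yes refl with fresh bs (a ∷ as)
    ...     | a' , Pa' , a'∉ , fa'∉ =
              a' , Pa' , (λ m → a'∉ (there m)) ,
              λ { (here fa'≡fa) → a'∉ (here (injective Pa' Pa fa'≡fa)) ; (there m) → fa'∉ m }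

StrictlyIncreasing : (ℕ → ℕ) → Set
StrictlyIncreasing f = ∀ k → f k < f (suc k)

module _ {f : ℕ → ℕ} (increasing : StrictlyIncreasing f) where

  increasing-< : ∀ {i j} → i < j → f i < f j
  increasing-< {i} {suc j} i<1+j with i ≟ j
  ... | yes refl = increasing i
  ... | no i≢j = <-trans (increasing-< (≤∧≢⇒< (≤-pred i<1+j) i≢j)) (increasing j)

  increasing-injective : ∀ {i j} → f i ≡ f j → i ≡ j
  increasing-injective {i} {j} fi≡fj with <-cmp i j
  ... | tri< i<j _ _ = ⊥-elim (<-irrefl fi≡fj (increasing-< i<j))
  ... | tri≈ _ i≡j _ = i≡j
  ... | tri> _ _ j<i = ⊥-elim (<-irrefl (sym fi≡fj) (increasing-< j<i))

  increasing-≥ : ∀ k → k ≤ f k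
  increasing-≥ zero = z≤n
  increasing-≥ (suc k) = ≤-<-trans (increasing-≥ k) (increasing k)

module IncreasingChoice {G : ℕ → Set} (unbounded : ∀ M → ∃[ n ] (M < n × G n)) (B : ℕ) where

  choice : ℕ → ℕ
  choice zero = proj₁ (unbounded B)
  choice (suc k) = proj₁ (unbounded (choice k))

  choice-satisfies : ∀ k → G (choice k)
  choice-satisfies zero = proj₂ (proj₂ (unbounded B))
  choice-satisfies (suc k) = proj₂ (proj₂ (unbounded (choice k)))

  choice-increasing : StrictlyIncreasing choice
  choice-increasing k = proj₁ (proj₂ (unbounded (choice k)))

  bound<choice : ∀ k → B < choice k
  bound<choice zero = proj₁ (proj₂ (unbounded B))
  bound<choice (suc k) = <-trans (bound<choice k) (choice-increasing k)

-- Fans and the trees they generate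

IsFan : Seq → (Seq → Set) → Set
IsFan s T = Infinite T × (∀ t → T t → s ⊏ t)
  × (∀ t t' n n' u u' → T t → T t' → t ≢ t' → t ≡ s ++ (n ∷ u) → t' ≡ s ++ (n' ∷ u') → n ≢ n')

module Fan {s : Seq} {T : Seq → Set} (fan : IsFan s T) where

  extends : ∀ {t} → T t → s ⊏ t
  extends {t} = proj₁ (proj₂ fan) t

  extends-by-value : ∀ {t} → T t → (s ∷ʳ at t (length s)) ⊑ t
  extends-by-value Tt with extends Tt
  ... | a , r , refl =
    subst (λ b → (s ∷ʳ b) ⊑ (s ++ (a ∷ r))) (sym (at-snoc-⊑ s (snoc-⊑ s a r))) (snoc-⊑ s a r)

  same-value⇒≡ : ∀ {a t t'} → T t → T t' → (s ∷ʳ a) ⊑ t → (s ∷ʳ a) ⊑ t' → t ≡ t'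
  same-value⇒≡ {a} {t} {t'} Tt Tt' sa⊑t sa⊑t' with ≡-dec _≟_ t t'
  ... | yes t≡t' = t≡t'
  ... | no t≢t' =
    let r , t≡ = ⊑-snoc-form sa⊑t ; r' , t'≡ = ⊑-snoc-form sa⊑t'
    in ⊥-elim (proj₂ (proj₂ fan) t t' a a r r' Tt Tt' t≢t' t≡ t'≡ refl)

  value-injective : ∀ {t t'} → T t → T t' → at t (length s) ≡ at t' (length s) → t ≡ t'
  value-injective Tt Tt' eq =
    same-value⇒≡ Tt Tt' (extends-by-value Tt) (subst (λ b → (s ∷ʳ b) ⊑ _) (sym eq) (extends-by-value Tt'))

  values-infinite : Infinite (λ a → ∃[ t ] (T t × (s ∷ʳ a) ⊑ t))
  values-infinite l with infinite-image (λ t → at t (length s)) _≟_ value-injective (proj₁ fan) l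
  ... | _ , (t , Tt , refl) , a∉ = _ , (t , Tt , extends-by-value Tt) , a∉

module NodeProperties {F : Family} (F∈R : InR F) where

  open module F-Fan {s} = Fan (F∈R s) using (extends; extends-by-value; same-value⇒≡)

  root-⊑ : ∀ {u n} → Nodes F u n → u ⊑ n
  root-⊑ {u} base = ⊑-refl u
  root-⊑ (step d Fmn) = ⊑-trans (root-⊑ d) (⊏⇒⊑ (extends Fmn))

  first-step : ∀ {u n} → Nodes F u n → n ≡ u ⊎ ∃[ c ] (F u c × Nodes F c n)
  first-step base = inj₁ refl
  first-step (step d Fmn) with first-step d
  ... | inj₁ refl = inj₂ (_ , Fmn , base)
  ... | inj₂ (c , Fuc , dcm) = inj₂ (c , Fuc , step dcm Fmn)

  siblings-below-common : ∀ {u c c' x} → F u c → F u c' → c ⊑ x → c' ⊑ x → c ≡ c'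
  siblings-below-common {u} Fuc Fuc' c⊑x c'⊑x =
    let ua⊑x = ⊑-trans (extends-by-value Fuc) c⊑x ; ub⊑x = ⊑-trans (extends-by-value Fuc') c'⊑x
    in same-value⇒≡ Fuc Fuc' (extends-by-value Fuc)
         (subst (λ b → (u ∷ʳ b) ⊑ _) (snoc-⊑-unique u ub⊑x ua⊑x) (extends-by-value Fuc'))

  node-above-node : ∀ {u m n} → Nodes F u m → Nodes F u n → m ⊑ n → Nodes F m n
  node-above-node base dn _ = dn
  node-above-node {n = n} (step dm Fmm') dn m'⊑n
    with first-step (node-above-node dm dn (⊑-trans (⊏⇒⊑ (extends Fmm')) m'⊑n))
  ... | inj₁ refl = ⊥-elim (⊏⇒⋢ (extends Fmm') m'⊑n)
  ... | inj₂ (c , Fmc , dcn) = subst (λ c → Nodes F c n) (siblings-below-common Fmc Fmm' (root-⊑ dcn) m'⊑n) dcn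

  child-⊑-node : ∀ {m n c y} → Nodes F m n → F m c → m ⊏ y → y ⊑ c → y ⊑ n → c ⊑ n
  child-⊑-node {m} {n} dn Fmc m⊏y y⊑c y⊑n with first-step dn
  ... | inj₁ refl = ⊥-elim (⊏⇒⋢ m⊏y y⊑n)
  ... | inj₂ (c' , Fmc' , dc'n) =
    let a , ma⊑y = ⊏⇒snoc-⊑ m⊏y
        b≡a = snoc-⊑-unique m (⊑-trans (extends-by-value Fmc') (root-⊑ dc'n)) (⊑-trans ma⊑y y⊑n)
        ma⊑c' = subst (λ b → (m ∷ʳ b) ⊑ c') b≡a (extends-by-value Fmc')
    in subst (_⊑ n) (same-value⇒≡ Fmc' Fmc ma⊑c' (⊑-trans ma⊑y y⊑c)) (root-⊑ dc'n)

  branching-node : ∀ {u n₁ n₂ y a b} → Nodes F u n₁ → Nodes F u n₂ → (y ∷ʳ a) ⊑ n₁ → (y ∷ʳ b) ⊑ n₂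
                 → a ≢ b → Nodes F u y
  branching-node {y = y} base dn₂ ya⊑u yb⊑n₂ a≢b =
    ⊥-elim (a≢b (snoc-⊑-unique y (⊑-trans ya⊑u (root-⊑ dn₂)) yb⊑n₂))
  branching-node {n₁ = n₁} {n₂} {y} {a} (step dm Fmn₁) dn₂ ya⊑n₁ yb⊑n₂ a≢b
    with snoc-⊑-or-⊑ n₁ ya⊑n₁ (⊏⇒⊑ (extends Fmn₁))
  ... | inj₁ ya⊑m = branching-node dm dn₂ ya⊑m yb⊑n₂ a≢b
  ... | inj₂ m⊑y with ⊑⇒≡⊎⊏ m⊑y
  ...   | inj₁ refl = dm
  ...   | inj₂ m⊏y =
    let y⊑n₂ = ⊑-trans (⊑-++ y [ _ ]) yb⊑n₂
        dn₂-from-m = node-above-node dm dn₂ (⊑-trans m⊑y y⊑n₂)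
        n₁⊑n₂ = child-⊑-node dn₂-from-m Fmn₁ m⊏y (⊑-trans (⊑-++ y [ a ]) ya⊑n₁) y⊑n₂
    in ⊥-elim (a≢b (snoc-⊑-unique y (⊑-trans ya⊑n₁ n₁⊑n₂) yb⊑n₂))

  successors-infinite : ∀ {u n} → Nodes F u n → Infinite (Succ (ps F u) n)
  successors-infinite {n = n} dn l with Fan.values-infinite (F∈R n) l
  ... | a , (t , Fnt , na⊑t) , a∉ = a , (t , step dn Fnt , na⊑t) , a∉

  branch-root : ∀ {s x} → Branch (ps F s) x → x ↾ length s ≡ s
  branch-root {s} {x} branch =
    let n , dn , x↾s⊑n = branch (length s) in ⊑-same-length n x↾s⊑n (root-⊑ dn) (length-↾ x (length s))

  branch-at-level : ∀ {s x} → Branch (ps F s) x → ∀ N → suc (length s) ≤ N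
                  → ∃[ c ] (F s c × (s ∷ʳ x (length s)) ⊑ c × ∃[ n ] (Nodes F c n × (x ↾ N) ⊑ n))
  branch-at-level {s} {x} branch N 1+s≤N with branch N
  ... | n , dn , x↾N⊑n with first-step dn
  ...   | inj₁ refl = ⊥-elim (<⇒≱ (subst (length n <_) (sym (length-↾ x N)) 1+s≤N) (length-⊑ x↾N⊑n))
  ...   | inj₂ (c , Fsc , dcn) =
    let sx⊑x↾N = subst (λ z → (z ∷ʳ x (length s)) ⊑ (x ↾ N)) (branch-root branch) (↾-⊑ x 1+s≤N)
        b≡x = snoc-⊑-unique s (⊑-trans (extends-by-value Fsc) (root-⊑ dcn)) (⊑-trans sx⊑x↾N x↾N⊑n)
    in c , Fsc , subst (λ b → (s ∷ʳ b) ⊑ c) b≡x (extends-by-value Fsc) , n , dcn , x↾N⊑n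

  branch-through-child : ∀ {s x} → Branch (ps F s) x
                       → ∃[ c ] (F s c × (∀ m → ∃[ n ] (Nodes F c n × (x ↾ m) ⊑ n)))
  branch-through-child {s} {x} branch with branch-at-level branch (suc (length s)) ≤-refl
  ... | c , Fsc , sx⊑c , _ = c , Fsc , through-c
    where
    through-c : ∀ m → ∃[ n ] (Nodes F c n × (x ↾ m) ⊑ n)
    through-c m =
      let N = suc (length s) + m
          c' , Fsc' , sx⊑c' , n , dc'n , x↾N⊑n = branch-at-level branch N (m≤m+n (suc (length s)) m)
      in n , subst (λ c → Nodes F c n) (same-value⇒≡ Fsc' Fsc sx⊑c' sx⊑c) dc'n ,
         ⊑-trans (↾-⊑ x (m≤n+m m (suc (length s)))) x↾N⊑n

enumeration-fan : ∀ {s} (E : ℕ → Seq) (val : ℕ → ℕ) → StrictlyIncreasing val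
                → (∀ k → (s ∷ʳ val k) ⊑ E k) → IsFan s (λ t → ∃[ k ] (t ≡ E k))
enumeration-fan {s} E val increasing sval⊑E = infinite , extends , distinct
  where
  Enumerated : Seq → Set
  Enumerated t = ∃[ k ] (t ≡ E k)

  infinite : Infinite Enumerated
  infinite = infinite-preimage {P = Enumerated} (λ t → at t (length s)) (unbounded⇒infinite λ M →
    val (suc M) , increasing-≥ increasing (suc M) , E (suc M) , (suc M , refl) , at-snoc-⊑ s (sval⊑E (suc M)))

  extends : ∀ t → Enumerated t → s ⊏ t
  extends _ (k , refl) = let r , eq = ⊑-snoc-form (sval⊑E k) in val k , r , eq

  value≡ : ∀ {k n u} → E k ≡ s ++ (n ∷ u) → val k ≡ n
  value≡ {k} {n} {u} eq = snoc-⊑-unique s (sval⊑E k) (subst ((s ∷ʳ n) ⊑_) (sym eq) (snoc-⊑ s n u))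

  distinct : ∀ t t' n n' u u' → Enumerated t → Enumerated t' → t ≢ t'
           → t ≡ s ++ (n ∷ u) → t' ≡ s ++ (n' ∷ u') → n ≢ n'
  distinct _ _ _ _ _ _ (k , refl) (k' , refl) Ek≢Ek' eq eq' refl =
    Ek≢Ek' (cong E (increasing-injective increasing (trans (value≡ eq) (sym (value≡ eq')))))

-- Superperfect and Miller trees

IsSuperperfect : Tree → Set
IsSuperperfect A = IsTree A × (∀ s → A s → ∃[ t ] (s ⊑ t × A t × Infinite (Succ A t)))

miller⇒superperfect : ∀ {A} → IsMiller A → IsSuperperfect A
miller⇒superperfect (tree , _ , splits) = tree , splits

restrict : Tree → Seq → Tree
restrict A z t = A t × Comparable t z

successor-⋢ : ∀ {A y w} → Infinite (Succ A y) → (∀ b → A (y ∷ʳ b) → Comparable w (y ∷ʳ b))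
            → ∀ b → ¬ ((y ∷ʳ b) ⊑ w)
successor-⋢ {y = y} inf comparable b yb⊑w with inf [ b ]
... | b' , Ayb' , b'∉ with comparable b' Ayb'
...   | inj₁ w⊑yb' = b'∉ (here (sym (snoc-⊑-unique y (⊑-trans yb⊑w w⊑yb') (⊑-refl _))))
...   | inj₂ yb'⊑w = b'∉ (here (snoc-⊑-unique y yb'⊑w yb⊑w))

⊑-splitting : ∀ {A y w} → Infinite (Succ A y) → (∀ b → A (y ∷ʳ b) → Comparable w (y ∷ʳ b)) → w ⊑ y
⊑-splitting {A} {y} inf comparable with inf []
... | b , Ayb , _ with comparable b Ayb
...   | inj₂ yb⊑w = ⊥-elim (successor-⋢ {A} inf comparable b yb⊑w)
...   | inj₁ w⊑yb with ⊑-snoc-split y b w⊑yb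
...     | inj₁ refl = ⊥-elim (successor-⋢ {A} inf comparable b (⊑-refl _))
...     | inj₂ w⊑y = w⊑y

restrict-successors : ∀ {A z t} → z ⊑ t → Infinite (Succ A t) → Infinite (Succ (restrict A z) t)
restrict-successors {t = t} z⊑t t-splits l with t-splits l
... | n , Atn , n∉ = n , (Atn , inj₂ (⊑-trans z⊑t (⊑-++ t [ n ]))) , n∉

restrict-miller : ∀ {A z} → IsSuperperfect A → A z → Infinite (Succ A z) → IsMiller (restrict A z)
restrict-miller {A} {z} ((A[] , A-closed) , A-splits) Az z-splits =
  ((A[] , inj₁ (⊑-[] z)) , closed) ,
  (z , (Az , inj₁ (⊑-refl z)) , (λ t At → comparable-sym (proj₂ At)) , maximal) ,
  splits
  where
  closed : ∀ s t → s ⊑ t → restrict A z t → restrict A z s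
  closed s t s⊑t (At , inj₁ t⊑z) = A-closed s t s⊑t At , inj₁ (⊑-trans s⊑t t⊑z)
  closed s t s⊑t (At , inj₂ z⊑t) = A-closed s t s⊑t At , ⊑-comparable t s⊑t z⊑t

  maximal : ∀ u → restrict A z u → (∀ t → restrict A z t → Comparable u t) → u ⊑ z
  maximal u _ comparable = ⊑-splitting {A} z-splits (λ b Azb → comparable (z ∷ʳ b) (Azb , inj₂ (⊑-++ z [ b ])))

  splits : ∀ s → restrict A z s → ∃[ t ] (s ⊑ t × restrict A z t × Infinite (Succ (restrict A z) t))
  splits s (As , inj₁ s⊑z) = z , s⊑z , (Az , inj₁ (⊑-refl z)) , restrict-successors {A} (⊑-refl z) z-splits
  splits s (As , inj₂ z⊑s) =
    let t , s⊑t , At , t-splits = A-splits s As ; z⊑t = ⊑-trans z⊑s s⊑t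
    in t , s⊑t , (At , inj₂ z⊑t) , restrict-successors {A} z⊑t t-splits

-- The construction

module Construction (X : (ℕ → ℕ) → Set) (X∈m⁰ : InM0 X) (P : Family) (P∈R : InR P) where

  open NodeProperties P∈R

  Avoids : Tree → Set
  Avoids T = ∀ x → Branch T x → ¬ X x

  record Piece (v : Seq) : Set₁ where
    field
      tree : Tree
      superperfect : IsSuperperfect tree
      root∈ : tree v
      root-splits : Infinite (Succ tree v)
      ⊆ps : tree ⊆′ ps P v

  open Piece

  rootPiece : ∀ v → Piece v
  rootPiece v = record
    { tree = ps P v
    ; superperfect = ((v , base , ⊑-[] v) , closed) , splits
    ; root∈ = v , base , ⊑-refl v
    ; root-splits = successors-infinite base
    ; ⊆ps = λ _ pst → pst
    }
    where
    closed : ∀ s t → s ⊑ t → ps P v t → ps P v s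
    closed s t s⊑t (n , dn , t⊑n) = n , dn , ⊑-trans s⊑t t⊑n
    splits : ∀ s → ps P v s → ∃[ t ] (s ⊑ t × ps P v t × Infinite (Succ (ps P v) t))
    splits s (n , dn , s⊑n) = n , s⊑n , (n , dn , ⊑-refl n) , successors-infinite dn

  module Children {v : Seq} (π : Piece v) (B : ℕ) where

    open IncreasingChoice (infinite⇒unbounded (root-splits π)) B
      renaming ( choice to value; choice-satisfies to value∈
               ; choice-increasing to value-increasing; bound<choice to bound<value)
      public

    -- Later arguments use only the properties stated here; unfolding them is very slow.
    opaque
      splitting-above : ∀ k → ∃[ z ] ((v ∷ʳ value k) ⊑ z × tree π z × Infinite (Succ (tree π) z))
      splitting-above k = proj₂ (superperfect π) (v ∷ʳ value k) (value∈ k)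

      cone : ℕ → Miller
      cone k = let z , _ , πz , z-splits = splitting-above k
               in restrict (tree π) z , restrict-miller (superperfect π) πz z-splits

      avoiding : ∀ k → Σ Miller λ q → q ≤M cone k × Avoids (proj₁ q)
      avoiding k = X∈m⁰ (cone k)

      shrunk : ℕ → Tree
      shrunk k = proj₁ (proj₁ (avoiding k))

      shrunk-miller : ∀ k → IsMiller (shrunk k)
      shrunk-miller k = proj₂ (proj₁ (avoiding k))

      shrunk⊆cone : ∀ k → shrunk k ⊆′ proj₁ (cone k)
      shrunk⊆cone k = proj₁ (proj₂ (avoiding k))

      splitting-in-shrunk : ∀ k → ∃[ y ] (shrunk k y × Infinite (Succ (shrunk k) y))
      splitting-in-shrunk k =
        let _ , (stem , stem∈ , _) , splits = shrunk-miller k ; y , _ , y∈ , y-splits = splits stem stem∈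
        in y , y∈ , y-splits

      child : ℕ → Seq
      child k = proj₁ (splitting-in-shrunk k)

      child∈ : ∀ k → shrunk k (child k)
      child∈ k = proj₁ (proj₂ (splitting-in-shrunk k))

      child-splits : ∀ k → Infinite (Succ (shrunk k) (child k))
      child-splits k = proj₂ (proj₂ (splitting-in-shrunk k))

      value⊑child : ∀ k → (v ∷ʳ value k) ⊑ child k
      value⊑child k = ⊑-trans (proj₁ (proj₂ (splitting-above k)))
        (⊑-splitting {shrunk k} (child-splits k) λ b in-shrunk → comparable-sym (proj₂ (shrunk⊆cone k _ in-shrunk)))

      shrunk⊆ps : ∀ k → shrunk k ⊆′ ps P v
      shrunk⊆ps k t in-shrunk = ⊆ps π t (proj₁ (shrunk⊆cone k t in-shrunk))

      child-node : ∀ k → Nodes P v (child k)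
      child-node k =
        let a , ya∈ , _ = child-splits k []
            b , yb∈ , b∉ = child-splits k [ a ]
            n₁ , dn₁ , ya⊑n₁ = shrunk⊆ps k _ ya∈
            n₂ , dn₂ , yb⊑n₂ = shrunk⊆ps k _ yb∈
        in branching-node dn₁ dn₂ ya⊑n₁ yb⊑n₂ (λ a≡b → b∉ (here (sym a≡b)))

      childPiece : ∀ k → Piece (child k)
      childPiece k = record
        { tree = restrict (shrunk k) (child k)
        ; superperfect =
            miller⇒superperfect (restrict-miller (miller⇒superperfect (shrunk-miller k)) (child∈ k) (child-splits k))
        ; root∈ = child∈ k , inj₁ (⊑-refl (child k))
        ; root-splits = restrict-successors {shrunk k} (⊑-refl (child k)) (child-splits k)
        ; ⊆ps = ⊆ps-child
        }
        where
        ⊆ps-child : restrict (shrunk k) (child k) ⊆′ ps P (child k)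
        ⊆ps-child t (in-shrunk , inj₁ t⊑y) = child k , base , t⊑y
        ⊆ps-child t (in-shrunk , inj₂ y⊑t) =
          let n , dn , t⊑n = shrunk⊆ps k t in-shrunk
          in n , node-above-node (child-node k) dn (⊑-trans y⊑t t⊑n) , t⊑n

      childPiece⊆ : ∀ k → tree (childPiece k) ⊆′ tree π
      childPiece⊆ k t (in-shrunk , _) = proj₁ (shrunk⊆cone k t in-shrunk)

      childPiece-avoids : ∀ k → Avoids (tree (childPiece k))
      childPiece-avoids k x branch = proj₂ (proj₂ (avoiding k)) x (λ n → proj₁ (branch n))

  subst-tree : ∀ {a b} (a≡b : a ≡ b) (π : Piece a) → tree (subst Piece a≡b π) ≡ tree π
  subst-tree refl π = refl

  record Stage : Set₁ where
    constructor stage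
    field
      node : Seq
      piece : Piece node
      bound : ℕ

  open Stage

  open module StageChildren (σ : Stage) = Children (piece σ) (bound σ)
    using (child; value; value-increasing; bound<value; value⊑child; childPiece; childPiece⊆; childPiece-avoids)

  node⊑child : ∀ σ k → node σ ⊑ child σ k
  node⊑child σ k = ⊑-trans (⊑-++ (node σ) [ value σ k ]) (value⊑child σ k)

  -- A parent (σ , j) of y has j ≤ value σ j = y (|node σ|), so the search for it is finite.
  candidates : Seq → List Stage → List (Stage × ℕ)
  candidates y σs = concatMap (λ σ → map (σ ,_) (upTo (suc (at y (length (node σ)))))) σs

  ∈-candidates : ∀ {σ σs j} y → σ ∈ σs → j ≤ at y (length (node σ)) → (σ , j) ∈ candidates y σs
  ∈-candidates y σ∈σs j≤ = ∈-concatMap⁺ _ (Any.map (λ { refl → ∈-map⁺ _ (∈-upTo⁺ (s≤s j≤)) }) σ∈σs)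

  candidate-∈ : ∀ {σ j} y σs → (σ , j) ∈ candidates y σs → σ ∈ σs
  candidate-∈ y σs m = Any.map (λ m' → let _ , _ , eq = ∈-map⁻ _ m' in cong proj₁ eq) (∈-concatMap⁻ _ m)

  IsParent : Seq → Stage × ℕ → Set
  IsParent y (σ , j) = child σ j ≡ y

  parent? : ∀ y σs → Dec (Any (IsParent y) (candidates y σs))
  parent? y σs = any? (λ c → ≡-dec _≟_ (child (proj₁ c) (proj₂ c)) y) (candidates y σs)

  boundFor : Seq → List Stage → ℕ
  boundFor y σs = max 0 (map (λ c → at (child (proj₁ c) (proj₂ c)) (length y)) (candidates y σs))

  candidate-≤-bound : ∀ {σ j} y σs → (σ , j) ∈ candidates y σs → at (child σ j) (length y) ≤ boundFor y σs
  candidate-≤-bound y σs m = All.lookup (xs≤max 0 _) (∈-map⁺ _ m)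

  pieceFor : (y : Seq) → List Stage → Piece y
  pieceFor y σs with parent? y σs
  ... | yes found = let (σ , j) , _ , σj-parent = find found in subst Piece σj-parent (childPiece σ j)
  ... | no _ = rootPiece y

  stageAt : Seq → List Stage → Stage
  stageAt y σs = stage y (pieceFor y σs) (boundFor y σs)

  -- ancestorsʳ (reverse s) are the stages of the proper prefixes of s; working on the
  -- reversal turns the course-of-values recursion over prefixes into structural recursion.
  ancestorsʳ : List ℕ → List Stage
  ancestorsʳ [] = []
  ancestorsʳ (a ∷ rs) = stageAt (reverse rs) (ancestorsʳ rs) ∷ ancestorsʳ rs

  ancestors : Seq → List Stage
  ancestors s = ancestorsʳ (reverse s)

  stageOf : Seq → Stage
  stageOf s = stageAt s (ancestors s)

  ancestor-is-stage : ∀ {σ} rs → σ ∈ ancestorsʳ rs → σ ≡ stageOf (node σ)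
  ancestor-is-stage (a ∷ rs) (here refl) =
    cong (λ z → stageAt (reverse rs) (ancestorsʳ z)) (sym (reverse-involutive rs))
  ancestor-is-stage (a ∷ rs) (there m) = ancestor-is-stage rs m

  ancestorsʳ-++ : ∀ {σ} xs rs → σ ∈ ancestorsʳ rs → σ ∈ ancestorsʳ (xs ++ rs)
  ancestorsʳ-++ [] rs m = m
  ancestorsʳ-++ (x ∷ xs) rs m = there (ancestorsʳ-++ xs rs m)

  prefix-ancestor : ∀ {p s} → p ⊏ s → stageOf p ∈ ancestors s
  prefix-ancestor {p} (a , w , refl) =
    subst (λ rs → stageOf p ∈ ancestorsʳ rs) (sym (reverse-extension p a w))
      (ancestorsʳ-++ (reverse w) (a ∷ reverse p)
        (here (cong (λ z → stageAt z (ancestorsʳ (reverse p))) (sym (reverse-involutive p)))))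

  -- If s extends p, a child y of p is a candidate parent of s, so bound at s exceeds
  -- y (|s|); every child of s is larger there.
  prefix-not-parent : ∀ {p s j k y} → p ⊏ s → child (stageOf p) j ≡ y → child (stageOf s) k ≡ y → ⊥
  prefix-not-parent {p} {s} {j} {k} p⊏s refl sk≡y =
    <⇒≱ (bound<value (stageOf s) k) (subst (_≤ bound (stageOf s)) y|s|≡value candidate-bound)
    where
    y : Seq
    y = child (stageOf p) j
    a : ℕ
    a = proj₁ (⊏⇒snoc-⊑ p⊏s)
    pa⊑s : (p ∷ʳ a) ⊑ s
    pa⊑s = proj₂ (⊏⇒snoc-⊑ p⊏s)
    svalue⊑y : (s ∷ʳ value (stageOf s) k) ⊑ y
    svalue⊑y = subst ((s ∷ʳ _) ⊑_) sk≡y (value⊑child (stageOf s) k)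
    y|s|≡value : at y (length s) ≡ value (stageOf s) k
    y|s|≡value = at-snoc-⊑ s svalue⊑y
    value≡a : value (stageOf p) j ≡ a
    value≡a = snoc-⊑-unique p (value⊑child (stageOf p) j) (⊑-trans pa⊑s (⊑-trans (⊑-++ s _) svalue⊑y))
    j≤ : j ≤ at s (length p)
    j≤ = ≤-trans (increasing-≥ (value-increasing (stageOf p)) j)
                 (≤-reflexive (trans value≡a (sym (at-snoc-⊑ p pa⊑s))))
    candidate-bound : at y (length s) ≤ bound (stageOf s)
    candidate-bound = candidate-≤-bound s (ancestors s) (∈-candidates s (prefix-ancestor p⊏s) j≤)

  parent-unique : ∀ {p s j k y} → child (stageOf p) j ≡ y → child (stageOf s) k ≡ y → p ≡ s
  parent-unique {p} {s} {j} {k} {y} pj≡y sk≡y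
    with ⊑-comparable y (subst (p ⊑_) pj≡y (node⊑child (stageOf p) j))
                        (subst (s ⊑_) sk≡y (node⊑child (stageOf s) k))
  ... | inj₁ p⊑s = [ id , (λ p⊏s → ⊥-elim (prefix-not-parent p⊏s pj≡y sk≡y)) ]′ (⊑⇒≡⊎⊏ p⊑s)
  ... | inj₂ s⊑p = [ sym , (λ s⊏p → ⊥-elim (prefix-not-parent s⊏p sk≡y pj≡y)) ]′ (⊑⇒≡⊎⊏ s⊑p)

  StageTree : Seq → Tree
  StageTree s = tree (piece (stageOf s))

  pieceFor-child : ∀ {s k} y σs → (∀ {σ} → σ ∈ σs → σ ≡ stageOf (node σ)) → stageOf s ∈ σs
                 → child (stageOf s) k ≡ y → tree (pieceFor y σs) ⊆′ StageTree s × Avoids (tree (pieceFor y σs))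
  pieceFor-child {s} {k} y σs stages s∈σs sk≡y with parent? y σs
  ... | no no-parent = ⊥-elim (no-parent (lose (∈-candidates y s∈σs k≤) sk≡y))
    where
    k≤ : k ≤ at y (length s)
    k≤ = ≤-trans (increasing-≥ (value-increasing (stageOf s)) k)
           (≤-reflexive (sym (at-snoc-⊑ s (subst ((s ∷ʳ _) ⊑_) sk≡y (value⊑child (stageOf s) k)))))
  ... | yes found with find found
  ...   | (σ , j) , m , σj≡y =
    from-parent (trans σ≡ (cong stageOf (parent-unique (subst (λ τ → child τ j ≡ y) σ≡ σj≡y) sk≡y)))
    where
    σ≡ : σ ≡ stageOf (node σ)
    σ≡ = stages (candidate-∈ y σs m)
    from-parent : σ ≡ stageOf s → tree (subst Piece σj≡y (childPiece σ j)) ⊆′ StageTree s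
                                × Avoids (tree (subst Piece σj≡y (childPiece σ j)))
    from-parent refl rewrite subst-tree σj≡y (childPiece σ j) = childPiece⊆ σ j , childPiece-avoids σ j

  child-stage : ∀ s k → StageTree (child (stageOf s) k) ⊆′ StageTree s × Avoids (StageTree (child (stageOf s) k))
  child-stage s k = pieceFor-child y (ancestors y) (ancestor-is-stage (reverse y)) (prefix-ancestor s⊏y) refl
    where
    y : Seq
    y = child (stageOf s) k
    s⊏y : s ⊏ y
    s⊏y = let r , eq = ⊑-snoc-form (value⊑child (stageOf s) k) in value (stageOf s) k , r , eq

  Q : Family
  Q s t = ∃[ k ] (t ≡ child (stageOf s) k)

  Q∈R : InR Q
  Q∈R s = let σ = stageOf s in enumeration-fan (child σ) (value σ) (value-increasing σ) (value⊑child σ)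

  Q-tree⊆ : ∀ {s n} → Nodes Q s n → StageTree n ⊆′ StageTree s
  Q-tree⊆ base t t∈n = t∈n
  Q-tree⊆ (step d (k , refl)) t t∈y = Q-tree⊆ d t (proj₁ (child-stage _ k) t t∈y)

  Q-node∈ : ∀ {s n} → Nodes Q s n → StageTree s n
  Q-node∈ {n = n} d = Q-tree⊆ d n (root∈ (piece (stageOf n)))

  Q≤P : Q ≤R P
  Q≤P s t (n , d , t⊑n) =
    let n' , d' , n⊑n' = ⊆ps (piece (stageOf s)) n (Q-node∈ d) in n' , d' , ⊑-trans t⊑n n⊑n'

  Q-branch : ∀ {c x} → (∀ m → ∃[ n ] (Nodes Q c n × (x ↾ m) ⊑ n)) → Branch (StageTree c) x
  Q-branch {c} {x} through m =
    let n , d , x↾m⊑n = through m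
    in proj₂ (proj₁ (superperfect (piece (stageOf c)))) (x ↾ m) n x↾m⊑n (Q-node∈ d)

  Q-avoids : ∀ s → Avoids (ps Q s)
  Q-avoids s x branch =
    let c , (k , c≡child) , through = NodeProperties.branch-through-child Q∈R branch
    in proj₂ (child-stage s k) x (subst (λ c → Branch (StageTree c) x) c≡child (Q-branch through))

fact1p6 : (X : (ℕ → ℕ) → Set) → InM0 X → (P : Family) → InR P
          → Σ Family λ Q → InR Q × Q ≤R P × (∀ s x → Branch (ps Q s) x → ¬ X x)
fact1p6 X X∈m⁰ P P∈R = Q , Q∈R , Q≤P , Q-avoids
  where open Construction X X∈m⁰ P P∈R
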